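{- Let $k$ be a nonnegative integer. There is a bijection between the set of nice order ideals of $M_{2k+1,2k+3}$ that do not contain the element $1$ and the set $\mathcal{FD}_k$ of free Dyck paths from $(0,0)$ to $(2k,0)$.
   Context: For coprime positive integers $s,t$, let $P_{s,t}=\mathbb{N}^+\setminus\{k_1s+k_2t\mid k_1,k_2\in\mathbb{N}\}$ (with $\mathbb N=\{0,1,2,\dots\}$), partially ordered by the reflexive-transitive closure of the cover relation: $x$ covers $y$ iff $x,y\in P_{s,t}$ and $x-y\in\{s,t\}$. $M_{2k+1,2k+3}$ is the subposet of $P_{2k+1,2k+3}$ obtained by removing all $y$ with $y\succeq 2k+2$. An order ideal is a down-closed subset; it is nice if it contains no two elements $x,y$ with $x-y=1$. A free Dyck path from $(0,0)$ to $(2k,0)$ is a lattice path using steps $U=(1,1)$ and $D=(1,-1)$ (with no restriction on going below the $x$-axis). -}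

module Defs where

open import Level using (0ℓ)
open import Data.Nat using (ℕ; zero; suc; _+_; _*_; _≤_)
open import Data.Integer using (ℤ; 0ℤ) renaming (_+_ to _+ℤ_; +_ to int; -_ to negℤ)
open import Data.Bool using (Bool; true; false)
open import Data.Vec using (Vec; []; _∷_)
open import Data.Product using (Σ; ∃; ∃-syntax; _×_; _,_; proj₁)
open import Data.Sum using (_⊎_)
open import Relation.Nullary using (¬_)
open import Relation.Binary.PropositionalEquality using (_≡_; refl; sym; trans)
open import Relation.Binary.Bundles using (Setoid)
open import Relation.Binary.Construct.Closure.ReflexiveTransitive using (Star)
open import Function.Bundles using (Bijection)

InP : ℕ → ℕ → ℕ → Set
InP s t x = (1 ≤ x) × ¬ (∃[ k₁ ] ∃[ k₂ ] (k₁ * s + k₂ * t ≡ x))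

Covers : ℕ → ℕ → ℕ → ℕ → Set
Covers s t y x = InP s t x × InP s t y × ((x ≡ y + s) ⊎ (x ≡ y + t))

Below : ℕ → ℕ → ℕ → ℕ → Set
Below s t = Star (Covers s t)

sₖ tₖ : ℕ → ℕ
sₖ k = 2 * k + 1
tₖ k = 2 * k + 3

InM : ℕ → ℕ → Set
InM k x = InP (sₖ k) (tₖ k) x × ¬ Below (sₖ k) (tₖ k) (2 * k + 2) x

BelowM : ℕ → ℕ → ℕ → Set
BelowM k = Below (sₖ k) (tₖ k)

Subset : Set
Subset = ℕ → Bool

_∈_ : ℕ → Subset → Set
x ∈ I = I x ≡ true

IsOrderIdeal : ℕ → Subset → Set
IsOrderIdeal k I =
  (∀ x → x ∈ I → InM k x) ×
  (∀ x y → x ∈ I → InM k y → BelowM k y x → y ∈ I)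

IsNice : Subset → Set
IsNice I = ∀ y → ¬ (y ∈ I × suc y ∈ I)

IsGoodIdeal : ℕ → Subset → Set
IsGoodIdeal k I = IsOrderIdeal k I × IsNice I × ¬ (1 ∈ I)

GoodIdeals : ℕ → Setoid 0ℓ 0ℓ
GoodIdeals k = record
  { Carrier = Σ Subset (IsGoodIdeal k)
  ; _≈_ = λ I J → ∀ x → proj₁ I x ≡ proj₁ J x
  ; isEquivalence = record
    { refl = λ x → refl
    ; sym = λ p x → sym (p x)
    ; trans = λ p q x → trans (p x) (q x)
    }
  }

data Step : Set where
  U D : Step

stepHeight : Step → ℤ
stepHeight U = int 1
stepHeight D = negℤ (int 1)

height : ∀ {n} → Vec Step n → ℤ
height []       = 0ℤ
height (s ∷ w)  = stepHeight s +ℤ height w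

FD : ℕ → Setoid 0ℓ 0ℓ
FD k = record
  { Carrier = Σ (Vec Step (2 * k)) (λ w → height w ≡ 0ℤ)
  ; _≈_ = λ p q → proj₁ p ≡ proj₁ q
  ; isEquivalence = record { refl = refl ; sym = sym ; trans = trans }
  }

-- Write t = 2k + 3.  The elements of M_{2k+1,2k+3} are exactly the numbers r·t + j
-- with 1 ≤ j and j + 2r ≤ 2k, a triangle in which x covers y iff (r, j) goes to
-- (r − 1, j) or to (r − 1, j + 2).  Group its points into the diagonals j + r − 1 = i,
-- 0 ≤ i < 2k.  A nice ideal meets each diagonal i in the rows a_i − 1, a_i − 3, …,
-- and down-closure and niceness determine the next diagonal except for row a_i, which
-- may be taken or not, giving a_{i+1} = a_i + 1 or a_i − 1 (0 stays 0).  Folding ℤ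
-- onto ℕ by n ↦ n, −1 − n ↦ n, these are the folded heights of a free path: each step
-- moves the folded height up or down (from 0, down means crossing between 0 and −1),
-- and the step is recovered from that choice and the current height.  The triangle
-- forces a_{2k} = 0, and parity excludes the height −1, so the path is closed;
-- conversely a closed path has folded height at most 2k − i at time i, which keeps
-- the rows it prescribes inside the triangle.

module Submission where

open import Defs
open import Algebra.Properties.CommutativeSemigroup using (x∙yz≈y∙xz)
open import Data.Bool using (Bool; true; false; not; _∧_)
open import Data.Bool.Properties
  using (not-involutive; not-injective; ¬-not; ∧-zeroʳ; ∧-conicalˡ; ∧-conicalʳ; T-≡)
open import Data.Empty using (⊥; ⊥-elim)
open import Data.Integer using (ℤ; +_; -[1+_]) renaming (_+_ to _+ℤ_)
import Data.Integer.Properties as ℤ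
open import Data.Nat using (ℕ; zero; suc; pred; _+_; _*_; _∸_; _≤_; _<_; _≤ᵇ_; _≤?_; z≤n; s≤s)
open import Data.Nat.DivMod using (_/_; _%_; m≡m%n+[m/n]*n; m%n<n; [m+kn]%n≡m%n; m<n⇒m%n≡m;
                                   +-distrib-/; m*n/n≡m; m*n%n≡0; m<n⇒m/n≡0)
open import Data.Nat.Properties
open import Data.Nat.Solver using (module +-*-Solver)
open +-*-Solver using (solve; _:+_; _:*_; _:=_; con)
open import Data.Product using (Σ; ∃; ∃-syntax; _×_; _,_; proj₁; proj₂)
open import Data.Sum using (_⊎_; inj₁; inj₂)
open import Data.Vec using (Vec; []; _∷_)
open import Function.Bundles using (Equivalence; Bijection)
open import Relation.Binary.Construct.Closure.ReflexiveTransitive using (ε; _◅_; _◅◅_)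
open import Relation.Binary.Definitions using (tri<; tri≈; tri>)
open import Relation.Binary.PropositionalEquality
open import Relation.Nullary using (¬_; yes; no; contradiction)
open import Relation.Nullary.Decidable using (_×-dec_)

-- Folded heights

fold : ℤ → ℕ
fold (+ n)    = n
fold -[1+ n ] = n

outward : Step → ℤ → Bool
outward U (+ _)    = true
outward D (+ _)    = false
outward U -[1+ _ ] = false
outward D -[1+ _ ] = true

stepFor : Bool → ℤ → Step
stepFor true  (+ _)    = U
stepFor false (+ _)    = D
stepFor true  -[1+ _ ] = D
stepFor false -[1+ _ ] = U

stepFor-outward : ∀ s z → stepFor (outward s z) z ≡ s
stepFor-outward U (+ _)    = refl
stepFor-outward D (+ _)    = refl
stepFor-outward U -[1+ _ ] = refl
stepFor-outward D -[1+ _ ] = refl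

outward-stepFor : ∀ b z → outward (stepFor b z) z ≡ b
outward-stepFor true  (+ _)    = refl
outward-stepFor false (+ _)    = refl
outward-stepFor true  -[1+ _ ] = refl
outward-stepFor false -[1+ _ ] = refl

move : Bool → ℕ → ℕ
move true  a = suc a
move false a = pred a

fold-step : ∀ s z → fold (stepHeight s +ℤ z) ≡ move (outward s z) (fold z)
fold-step U (+ _)          = refl
fold-step U -[1+ zero ]    = refl
fold-step U -[1+ suc _ ]   = refl
fold-step D (+ zero)       = refl
fold-step D (+ suc _)      = refl
fold-step D -[1+ _ ]       = refl

fold-stepFor : ∀ b z → fold (stepHeight (stepFor b z) +ℤ z) ≡ move b (fold z)
fold-stepFor b z =
  trans (fold-step (stepFor b z) z) (cong (λ c → move c (fold z)) (outward-stepFor b z))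

move-≤ : ∀ b a → move b a ≤ suc a
move-≤ true  a = ≤-refl
move-≤ false a = ≤-trans pred[n]≤n (n≤1+n a)

≤-suc-move : ∀ b a → a ≤ suc (move b a)
≤-suc-move true  a       = ≤-trans (n≤1+n a) (n≤1+n (suc a))
≤-suc-move false zero    = z≤n
≤-suc-move false (suc a) = ≤-refl

odd : ℕ → Bool
odd zero    = false
odd (suc n) = not (odd n)

odd-2* : ∀ k → odd (2 * k) ≡ false
odd-2* zero    = refl
odd-2* (suc k) = trans (cong odd (*-suc 2 k)) (trans (not-involutive _) (odd-2* k))

oddℤ : ℤ → Bool
oddℤ (+ n)    = odd n
oddℤ -[1+ n ] = not (odd n)

oddℤ-step : ∀ s z → oddℤ (stepHeight s +ℤ z) ≡ not (oddℤ z)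
oddℤ-step U (+ _)           = refl
oddℤ-step U -[1+ zero ]     = refl
oddℤ-step U -[1+ suc _ ]    = sym (not-involutive _)
oddℤ-step D (+ zero)        = refl
oddℤ-step D (+ suc _)       = sym (not-involutive _)
oddℤ-step D -[1+ _ ]        = refl

fold≡0∧even⇒≡0 : ∀ z → fold z ≡ 0 → oddℤ z ≡ false → z ≡ + 0
fold≡0∧even⇒≡0 (+ zero)    _ _  = refl
fold≡0∧even⇒≡0 -[1+ zero ] _ ()

-- Past its end a path is padded with D steps; only indices below the length matter.
stepAt : ∀ {n} → Vec Step n → ℕ → Step
stepAt []      _       = D
stepAt (s ∷ w) zero    = s
stepAt (s ∷ w) (suc i) = stepAt w i

heightAt : ∀ {n} → Vec Step n → ℕ → ℤ
heightAt w zero    = + 0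
heightAt w (suc i) = stepHeight (stepAt w i) +ℤ heightAt w i

foldAt : ∀ {n} → Vec Step n → ℕ → ℕ
foldAt w i = fold (heightAt w i)

outwardAt : ∀ {n} → Vec Step n → ℕ → Bool
outwardAt w i = outward (stepAt w i) (heightAt w i)

foldAt-suc : ∀ {n} (w : Vec Step n) i → foldAt w (suc i) ≡ move (outwardAt w i) (foldAt w i)
foldAt-suc w i = fold-step (stepAt w i) (heightAt w i)

heightAt-∷ : ∀ {n} s (w : Vec Step n) i → heightAt (s ∷ w) (suc i) ≡ stepHeight s +ℤ heightAt w i
heightAt-∷ s w zero    = refl
heightAt-∷ s w (suc i) = begin
  stepHeight (stepAt w i) +ℤ heightAt (s ∷ w) (suc i)
    ≡⟨ cong (stepHeight (stepAt w i) +ℤ_) (heightAt-∷ s w i) ⟩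
  stepHeight (stepAt w i) +ℤ (stepHeight s +ℤ heightAt w i)
    ≡⟨ x∙yz≈y∙xz ℤ.+-commutativeSemigroup (stepHeight (stepAt w i)) (stepHeight s) (heightAt w i) ⟩
  stepHeight s +ℤ heightAt w (suc i)
    ∎
  where open ≡-Reasoning

height≡heightAt : ∀ {n} (w : Vec Step n) → height w ≡ heightAt w n
height≡heightAt []               = refl
height≡heightAt {suc n} (s ∷ w) =
  trans (cong (stepHeight s +ℤ_) (height≡heightAt w)) (sym (heightAt-∷ s w n))

fromFun : (n : ℕ) → (ℕ → Step) → Vec Step n
fromFun zero    f = []
fromFun (suc n) f = f 0 ∷ fromFun n (λ i → f (suc i))

stepAt-fromFun : ∀ n f i → i < n → stepAt (fromFun n f) i ≡ f i
stepAt-fromFun (suc n) f zero    _       = refl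
stepAt-fromFun (suc n) f (suc i) (s≤s p) = stepAt-fromFun n (λ i → f (suc i)) i p

fromFun-stepAt : ∀ {n} (w : Vec Step n) f → (∀ i → i < n → f i ≡ stepAt w i) → fromFun n f ≡ w
fromFun-stepAt []      f h = refl
fromFun-stepAt (s ∷ w) f h =
  cong₂ _∷_ (h 0 (s≤s z≤n)) (fromFun-stepAt w (λ i → f (suc i)) (λ i p → h (suc i) (s≤s p)))

fromFun-cong : ∀ n {f g} → (∀ i → f i ≡ g i) → fromFun n f ≡ fromFun n g
fromFun-cong zero    h = refl
fromFun-cong (suc n) h = cong₂ _∷_ (h 0) (fromFun-cong n (λ i → h (suc i)))

heightAt-fromFun : ∀ n f (z : ℕ → ℤ) → z 0 ≡ + 0 → (∀ i → z (suc i) ≡ stepHeight (f i) +ℤ z i) →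
                   ∀ i → i ≤ n → heightAt (fromFun n f) i ≡ z i
heightAt-fromFun n f z z₀ zₛ zero    _ = sym z₀
heightAt-fromFun n f z z₀ zₛ (suc i) p =
  trans (cong₂ (λ s h → stepHeight s +ℤ h) (stepAt-fromFun n f i p)
                                          (heightAt-fromFun n f z z₀ zₛ i (≤-trans (n≤1+n i) p)))
        (sym (zₛ i))

foldAt-≤ : ∀ {n} (w : Vec Step n) i → foldAt w i ≤ i
foldAt-≤ w zero    = z≤n
foldAt-≤ w (suc i) rewrite foldAt-suc w i =
  ≤-trans (move-≤ (outwardAt w i) (foldAt w i)) (s≤s (foldAt-≤ w i))

foldAt-≤-remaining : ∀ {n} (w : Vec Step n) → heightAt w n ≡ + 0 → ∀ d i → i + d ≡ n → foldAt w i ≤ d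
foldAt-≤-remaining w closed zero i e rewrite +-identityʳ i | e | closed = z≤n
foldAt-≤-remaining w closed (suc d) i e =
  ≤-trans (≤-suc-move (outwardAt w i) (foldAt w i))
    (s≤s (subst (_≤ d) (foldAt-suc w i)
                (foldAt-≤-remaining w closed d (suc i) (trans (sym (+-suc i d)) e))))

-- occupied r a holds iff r < a and a − r is odd, i.e. r ∈ {a − 1, a − 3, …}.
occupied : ℕ → ℕ → Bool
occupied r       zero    = false
occupied zero    (suc a) = not (odd a)
occupied (suc r) (suc a) = occupied r a

occupied⇒< : ∀ r a → occupied r a ≡ true → r < a
occupied⇒< zero    (suc a) _ = s≤s z≤n
occupied⇒< (suc r) (suc a) h = s≤s (occupied⇒< r a h)

≤⇒¬occupied : ∀ r a → a ≤ r → occupied r a ≡ false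
≤⇒¬occupied r a a≤r with occupied r a in e
... | false = refl
... | true  = ⊥-elim (<⇒≱ (occupied⇒< r a e) a≤r)

occupied-move-self : ∀ b a → occupied a (move b a) ≡ b
occupied-move-self true  zero    = refl
occupied-move-self true  (suc a) = occupied-move-self true a
occupied-move-self false a       = ≤⇒¬occupied a (pred a) pred[n]≤n

occupied-+2 : ∀ r a → occupied r a ≡ true → occupied r (2 + a) ≡ true
occupied-+2 zero    (suc a) h rewrite not-involutive (odd a) = h
occupied-+2 (suc r) (suc a) h = occupied-+2 r a h

occupied-suc-exclusive : ∀ r a → occupied r a ≡ true → occupied r (suc a) ≡ true → ⊥
occupied-suc-exclusive zero    (suc a) h₁ h₂ = contradiction (trans (cong not (sym h₁)) h₂) λ ()
occupied-suc-exclusive (suc r) (suc a) h₁ h₂ = occupied-suc-exclusive r a h₁ h₂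

occupied-alternates : ∀ r a → r < a → occupied r a ≡ false → occupied (suc r) a ≡ true
occupied-alternates zero    (suc zero)    _       ()
occupied-alternates zero    (suc (suc a)) _       h = not-injective h
occupied-alternates (suc r) (suc a)       (s≤s p) h = occupied-alternates r a p h

occupied-move-exclusive : ∀ b r a → occupied r a ≡ true → occupied r (move b a) ≡ true → ⊥
occupied-move-exclusive true  r a       h₁ h₂ = occupied-suc-exclusive r a h₁ h₂
occupied-move-exclusive false r (suc a) h₁ h₂ = occupied-suc-exclusive r a h₂ h₁

occupied-suc-move⇒occupied : ∀ b r a → occupied (suc r) (move b a) ≡ true → occupied r a ≡ true
occupied-suc-move⇒occupied true  r a             h = h
occupied-suc-move⇒occupied false r (suc (suc a)) h = occupied-+2 r a h

occupied-suc⇒occupied-move : ∀ b r a → occupied (suc r) a ≡ true → occupied r (move b a) ≡ true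
occupied-suc⇒occupied-move true  r (suc a) h = occupied-+2 r a h
occupied-suc⇒occupied-move false r (suc a) h = h

-- M_{2k+1,2k+3} as a triangle

∧-implied : ∀ f o → (o ≡ true → f ≡ true) → f ∧ o ≡ o
∧-implied f true  f⇐o = cong (_∧ true) (f⇐o refl)
∧-implied f false _   = ∧-zeroʳ f

module _ (k : ℕ) where

  K S T : ℕ
  K = 2 * k
  S = suc K
  T = 3 + K

  sₖ≡S : sₖ k ≡ S
  sₖ≡S = +-comm K 1

  tₖ≡T : tₖ k ≡ T
  tₖ≡T = +-comm K 3

  point : ℕ → ℕ → ℕ
  point r j = r * T + j

  InTriangle : ℕ → ℕ → Set
  InTriangle r j = 1 ≤ j × j + (r + r) ≤ K

  Triangular : ℕ → Set
  Triangular x = ∃[ r ] ∃[ j ] InTriangle r j × x ≡ point r j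

  point-/ : ∀ r j → j < T → point r j / T ≡ r
  point-/ r j j<T = begin
    (r * T + j) / T       ≡⟨ +-distrib-/ (r * T) j (subst (λ m → m + j % T < T) (sym (m*n%n≡0 r T))
                                                         (subst (_< T) (sym (m<n⇒m%n≡m j<T)) j<T)) ⟩
    r * T / T + j / T     ≡⟨ cong₂ _+_ (m*n/n≡m r T) (m<n⇒m/n≡0 j<T) ⟩
    r + 0                 ≡⟨ +-identityʳ r ⟩
    r                     ∎
    where open ≡-Reasoning

  point-% : ∀ r j → j < T → point r j % T ≡ j
  point-% r j j<T = begin
    (r * T + j) % T       ≡⟨ cong (_% T) (+-comm (r * T) j) ⟩
    (j + r * T) % T       ≡⟨ [m+kn]%n≡m%n j r T ⟩
    j % T                 ≡⟨ m<n⇒m%n≡m j<T ⟩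
    j                     ∎
    where open ≡-Reasoning

  point-injective : ∀ {r r′ j j′} → j < T → j′ < T → point r j ≡ point r′ j′ → r ≡ r′ × j ≡ j′
  point-injective {r} {r′} {j} {j′} j<T j′<T e =
    trans (sym (point-/ r j j<T)) (trans (cong (_/ T) e) (point-/ r′ j′ j′<T)) ,
    trans (sym (point-% r j j<T)) (trans (cong (_% T) e) (point-% r′ j′ j′<T))

  point-/% : ∀ x → x ≡ point (x / T) (x % T)
  point-/% x = trans (m≡m%n+[m/n]*n x T) (+-comm (x % T) _)

  InTriangle⇒suc<T : ∀ {r j} → InTriangle r j → suc j < T
  InTriangle⇒suc<T {r} {j} (_ , h) = s≤s (s≤s (≤-trans (m≤m+n j (r + r)) (≤-trans h (n≤1+n K))))

  InTriangle⇒<T : ∀ {r j} → InTriangle r j → j < T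
  InTriangle⇒<T {r} {j} t = ≤-trans (n≤1+n (suc j)) (InTriangle⇒suc<T {r} t)

  point-suc≡+T : ∀ r j → point (suc r) j ≡ point r j + T
  point-suc≡+T r j = solve 3 (λ K r j → (con 3 :+ K) :+ r :* (con 3 :+ K) :+ j
                                      := (r :* (con 3 :+ K) :+ j) :+ (con 3 :+ K)) refl K r j

  point-suc≡+S : ∀ r j → point (suc r) j ≡ point r (2 + j) + S
  point-suc≡+S r j = solve 3 (λ K r j → (con 3 :+ K) :+ r :* (con 3 :+ K) :+ j
                                      := (r :* (con 3 :+ K) :+ (con 2 :+ j)) :+ (con 1 :+ K)) refl K r j

  generator-sum : ∀ a b → (a + b) * T ≡ a * S + b * T + (a + a)
  generator-sum a b = solve 3 (λ a b K → (a :+ b) :* (con 3 :+ K)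
                                       := a :* (con 1 :+ K) :+ b :* (con 3 :+ K) :+ (a :+ a)) refl a b K

  triangle-unrepresentable : ∀ {r j} a b → InTriangle r j → a * S + b * T ≢ point r j
  triangle-unrepresentable {r} {j} a b (1≤j , fits) e with a + b ≤? r
  ... | yes a+b≤r = <-irrefl refl (begin-strict
        (a + b) * T           ≤⟨ *-monoˡ-≤ T a+b≤r ⟩
        r * T                 <⟨ m<m+n (r * T) 1≤j ⟩
        point r j             ≤⟨ m≤m+n _ (a + a) ⟩
        point r j + (a + a)   ≡⟨ sym (trans (generator-sum a b) (cong (_+ (a + a)) e)) ⟩
        (a + b) * T           ∎)
    where open ≤-Reasoning
  ... | no a+b≰r with m≤n⇒∃[o]m+o≡n (≰⇒> a+b≰r)
  ...   | d , r+1+d≡a+b = <-irrefl refl (begin-strict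
        T + (d + d)                     ≤⟨ +-monoʳ-≤ T d+d≤d*T ⟩
        T + d * T                       ≡⟨ T+dT≡j+2a ⟩
        j + (a + a)                     ≤⟨ +-monoʳ-≤ j (+-mono-≤ a≤ a≤) ⟩
        j + (suc r + d + (suc r + d))   ≡⟨ solve 3 (λ j r d → j :+ ((con 1 :+ r :+ d) :+ (con 1 :+ r :+ d))
                                                  := (j :+ (r :+ r)) :+ (con 2 :+ (d :+ d))) refl j r d ⟩
        j + (r + r) + (2 + (d + d))     <⟨ s≤s (+-monoˡ-≤ (2 + (d + d)) fits) ⟩
        suc (K + (2 + (d + d)))         ≡⟨ solve 2 (λ K d → con 1 :+ (K :+ (con 2 :+ (d :+ d)))
                                                  := (con 3 :+ K) :+ (d :+ d)) refl K d ⟩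
        T + (d + d)                     ∎)
    where
      open ≤-Reasoning
      d+d≤d*T : d + d ≤ d * T
      d+d≤d*T = subst (_≤ d * T) (solve 1 (λ d → d :* con 2 := d :+ d) refl d) (*-monoʳ-≤ d (s≤s (s≤s z≤n)))
      a≤ : a ≤ suc r + d
      a≤ = subst (a ≤_) (sym r+1+d≡a+b) (m≤m+n a b)
      T+dT≡j+2a : T + d * T ≡ j + (a + a)
      T+dT≡j+2a = +-cancelˡ-≡ (r * T) _ _ (begin-equality
        r * T + (T + d * T)     ≡⟨ solve 3 (λ K r d → r :* (con 3 :+ K) :+ ((con 3 :+ K) :+ d :* (con 3 :+ K))
                                              := (con 1 :+ r :+ d) :* (con 3 :+ K)) refl K r d ⟩
        (suc r + d) * T         ≡⟨ cong (_* T) r+1+d≡a+b ⟩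
        (a + b) * T             ≡⟨ trans (generator-sum a b) (cong (_+ (a + a)) e) ⟩
        point r j + (a + a)     ≡⟨ +-assoc (r * T) j (a + a) ⟩
        r * T + (j + (a + a))   ∎)

  InPₖ : ℕ → Set
  InPₖ = InP (sₖ k) (tₖ k)

  _⋖_ : ℕ → ℕ → Set
  y ⋖ x = x ≡ y + S ⊎ x ≡ y + T

  Covers⇒⋖ : ∀ {y x} → Covers (sₖ k) (tₖ k) y x → y ⋖ x
  Covers⇒⋖ {y} (_ , _ , inj₁ e) = inj₁ (trans e (cong (_+_ y) sₖ≡S))
  Covers⇒⋖ {y} (_ , _ , inj₂ e) = inj₂ (trans e (cong (_+_ y) tₖ≡T))

  ⋖⇒Covers : ∀ {y x} → InPₖ x → InPₖ y → y ⋖ x → Covers (sₖ k) (tₖ k) y x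
  ⋖⇒Covers {y} x∈P y∈P (inj₁ e) = x∈P , y∈P , inj₁ (trans e (cong (_+_ y) (sym sₖ≡S)))
  ⋖⇒Covers {y} x∈P y∈P (inj₂ e) = x∈P , y∈P , inj₂ (trans e (cong (_+_ y) (sym tₖ≡T)))

  InP-⋖ : ∀ {y x} → InPₖ x → y ⋖ x → 1 ≤ y → InPₖ y
  InP-⋖ {y} (_ , x∉) (inj₁ e) 1≤y = 1≤y , λ (a , b , rep) → x∉ (suc a , b , (begin
    suc a * sₖ k + b * tₖ k     ≡⟨ solve 4 (λ s t a b → (con 1 :+ a) :* s :+ b :* t := (a :* s :+ b :* t) :+ s)
                                          refl (sₖ k) (tₖ k) a b ⟩
    a * sₖ k + b * tₖ k + sₖ k  ≡⟨ cong₂ _+_ rep sₖ≡S ⟩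
    y + S                       ≡⟨ sym e ⟩
    _                           ∎))
    where open ≡-Reasoning
  InP-⋖ {y} (_ , x∉) (inj₂ e) 1≤y = 1≤y , λ (a , b , rep) → x∉ (a , suc b , (begin
    a * sₖ k + suc b * tₖ k     ≡⟨ solve 4 (λ s t a b → a :* s :+ (con 1 :+ b) :* t := (a :* s :+ b :* t) :+ t)
                                          refl (sₖ k) (tₖ k) a b ⟩
    a * sₖ k + b * tₖ k + tₖ k  ≡⟨ cong₂ _+_ rep tₖ≡T ⟩
    y + T                       ≡⟨ sym e ⟩
    _                           ∎))
    where open ≡-Reasoning

  InTriangle-downT : ∀ {r j} → InTriangle (suc r) j → InTriangle r j
  InTriangle-downT {r} {j} (1≤j , fits) = 1≤j , ≤-trans (+-monoʳ-≤ j (+-mono-≤ (n≤1+n r) (n≤1+n r))) fits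

  InTriangle-downS : ∀ {r j} → InTriangle (suc r) j → InTriangle r (2 + j)
  InTriangle-downS {r} {j} (_ , fits) =
    s≤s z≤n ,
    subst (_≤ K) (solve 2 (λ j r → j :+ ((con 1 :+ r) :+ (con 1 :+ r)) := (con 2 :+ j) :+ (r :+ r)) refl j r) fits

  InTriangle-⋖ : ∀ {r j y} → InTriangle r j → y ⋖ point r j →
                 ∃[ r′ ] r ≡ suc r′ × (y ≡ point r′ (2 + j) ⊎ y ≡ point r′ j)
  InTriangle-⋖ {zero} {j} {y} (_ , fits) y⋖j = ⊥-elim (<⇒≱ (S≤ y⋖j) (≤-trans (m≤m+n j 0) fits))
    where
      S≤ : y ⋖ j → S ≤ j
      S≤ (inj₁ e) = subst (S ≤_) (sym e) (m≤n+m S y)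
      S≤ (inj₂ e) = subst (S ≤_) (sym e) (≤-trans (m≤n+m S 2) (m≤n+m T y))
  InTriangle-⋖ {suc r} {j} _ (inj₁ e) = r , refl , inj₁ (+-cancelʳ-≡ S _ _ (trans (sym e) (point-suc≡+S r j)))
  InTriangle-⋖ {suc r} {j} _ (inj₂ e) = r , refl , inj₂ (+-cancelʳ-≡ T _ _ (trans (sym e) (point-suc≡+T r j)))

  Triangular-⋖ : ∀ {y x} → Triangular x → y ⋖ x → Triangular y
  Triangular-⋖ (r , j , t , refl) y⋖x with InTriangle-⋖ {r} {j} t y⋖x
  ... | r′ , refl , inj₁ refl = r′ , 2 + j , InTriangle-downS t , refl
  ... | r′ , refl , inj₂ refl = r′ , j , InTriangle-downT t , refl

  Triangular-below : ∀ {y x} → BelowM k y x → Triangular x → Triangular y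
  Triangular-below ε            t = t
  Triangular-below (y⋖z ◅ z≼x) t = Triangular-⋖ (Triangular-below z≼x t) (Covers⇒⋖ y⋖z)

  ¬Triangular-2k+2 : ¬ Triangular (2 * k + 2)
  ¬Triangular-2k+2 (zero , j , (_ , fits) , e) =
    <⇒≱ (subst (K <_) e (m<m+n K (s≤s z≤n))) (≤-trans (m≤m+n j 0) fits)
  ¬Triangular-2k+2 (suc r , j , _ , e) =
    <⇒≢ (≤-trans (subst (_< T) (+-comm 2 K) (n<1+n (2 + K))) (≤-trans (m≤m+n T (r * T)) (m≤m+n _ j))) e

  Triangular⇒InM : ∀ {x} → Triangular x → InM k x
  Triangular⇒InM x∈▵@(r , j , inT@(1≤j , _) , refl) =
    (≤-trans 1≤j (m≤n+m j (r * T)) ,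
     λ (a , b , rep) → triangle-unrepresentable {r} a b inT
                         (subst₂ (λ s t → a * s + b * t ≡ point r j) sₖ≡S tₖ≡T rep)) ,
    λ 2k+2≼x → ¬Triangular-2k+2 (Triangular-below 2k+2≼x x∈▵)

  -- Walk down by t while (r − 1, j) is still outside the triangle, otherwise by s to (r − 1, j + 2).
  ¬InTriangle⇒above : ∀ r j → j < T → InPₖ (point r j) → ¬ InTriangle r j → BelowM k (2 * k + 2) (point r j)
  ¬InTriangle⇒above r zero _ (_ , x∉) _ =
    ⊥-elim (x∉ (0 , r , trans (cong (r *_) tₖ≡T) (sym (+-identityʳ (r * T)))))
  ¬InTriangle⇒above zero (suc j) (s≤s j<2+K) (_ , x∉) ∉▵ with m≤n⇒m<n∨m≡n j<2+K
  ... | inj₂ 1+j≡2+K = subst (λ v → BelowM k v (suc j)) (trans 1+j≡2+K (+-comm 2 K)) ε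
  ... | inj₁ (s≤s 1+j≤S) =
    ⊥-elim (x∉ (1 , 0 , trans (+-identityʳ _) (trans (+-identityʳ _) (trans sₖ≡S (sym 1+j≡S)))))
    where
      K<1+j : K < suc j
      K<1+j = subst (K <_) (+-identityʳ (suc j)) (≰⇒> λ fits → ∉▵ (s≤s z≤n , fits))
      1+j≡S : suc j ≡ S
      1+j≡S = ≤-antisym 1+j≤S K<1+j
  ¬InTriangle⇒above (suc r) (suc j) j<T x∈P ∉▵ with suc j + (r + r) ≤? K
  ... | no ∉▵′ =
    ¬InTriangle⇒above r (suc j) j<T y∈P (λ (_ , fits) → ∉▵′ fits) ◅◅ (⋖⇒Covers x∈P y∈P y⋖x ◅ ε)
    where
      y⋖x : point r (suc j) ⋖ point (suc r) (suc j)
      y⋖x = inj₂ (point-suc≡+T r (suc j))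
      y∈P : InPₖ (point r (suc j))
      y∈P = InP-⋖ x∈P y⋖x (≤-trans (s≤s z≤n) (m≤n+m (suc j) (r * T)))
  ... | yes fits = ¬InTriangle⇒above r (3 + j) 3+j<T y∈P ∉▵′ ◅◅ (⋖⇒Covers x∈P y∈P y⋖x ◅ ε)
    where
      y⋖x : point r (3 + j) ⋖ point (suc r) (suc j)
      y⋖x = inj₁ (point-suc≡+S r (suc j))
      y∈P : InPₖ (point r (3 + j))
      y∈P = InP-⋖ x∈P y⋖x (≤-trans (s≤s z≤n) (m≤n+m (3 + j) (r * T)))
      3+j<T : 3 + j < T
      3+j<T = s≤s (s≤s (s≤s (≤-trans (m≤m+n (suc j) (r + r)) fits)))
      ∉▵′ : ¬ InTriangle r (3 + j)
      ∉▵′ (_ , fits′) = ∉▵ (s≤s z≤n , subst (_≤ K) (solve 2 (λ j r → (con 3 :+ j) :+ (r :+ r)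
                                          := (con 1 :+ j) :+ ((con 1 :+ r) :+ (con 1 :+ r))) refl j r) fits′)

  InM⇒Triangular : ∀ {x} → InM k x → Triangular x
  InM⇒Triangular {x} (x∈P , x⋡2k+2) with 1 ≤? x % T ×-dec x % T + (x / T + x / T) ≤? K
  ... | yes x∈▵ = x / T , x % T , x∈▵ , point-/% x
  ... | no  x∉▵ = ⊥-elim (x⋡2k+2 (subst (BelowM k (2 * k + 2)) (sym (point-/% x))
                    (¬InTriangle⇒above (x / T) (x % T) (m%n<n x T) (subst InPₖ (point-/% x) x∈P) x∉▵)))

-- The ideal of a path

  fits : ℕ → ℕ → Bool
  fits r j = j + (r + r) ≤ᵇ K

  fits⇒≤ : ∀ r j → fits r j ≡ true → j + (r + r) ≤ K
  fits⇒≤ r j e = ≤ᵇ⇒≤ (j + (r + r)) K (Equivalence.from T-≡ e)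

  ≤⇒fits : ∀ r j → j + (r + r) ≤ K → fits r j ≡ true
  ≤⇒fits r j h = Equivalence.to T-≡ (≤⇒≤ᵇ h)

  -- The point (r, j + 1) lies on the diagonal j + r.
  idealAt : ∀ {n} → Vec Step n → ℕ → ℕ → Bool
  idealAt w r zero    = false
  idealAt w r (suc j) = fits r (suc j) ∧ occupied r (foldAt w (j + r))

  pathIdeal : ∀ {n} → Vec Step n → Subset
  pathIdeal w x = idealAt w (x / T) (x % T)

  pathIdeal-point : ∀ {n} (w : Vec Step n) r j → j < T → pathIdeal w (point r j) ≡ idealAt w r j
  pathIdeal-point w r j j<T = cong₂ (idealAt w) (point-/ r j j<T) (point-% r j j<T)

  idealAt⇒InTriangle : ∀ {n} (w : Vec Step n) r j → idealAt w r j ≡ true → InTriangle r j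
  idealAt⇒InTriangle w r (suc j) e = s≤s z≤n , fits⇒≤ r (suc j) (∧-conicalˡ _ _ e)

  idealAt⇒occupied : ∀ {n} (w : Vec Step n) r j → idealAt w r (suc j) ≡ true →
                     occupied r (foldAt w (j + r)) ≡ true
  idealAt⇒occupied w r j e = ∧-conicalʳ (fits r (suc j)) _ e

  idealAt-intro : ∀ {n} (w : Vec Step n) r j → InTriangle r (suc j) → occupied r (foldAt w (j + r)) ≡ true →
                  pathIdeal w (point r (suc j)) ≡ true
  idealAt-intro w r j t occ rewrite pathIdeal-point w r (suc j) (InTriangle⇒<T {r} t)
                                  | ≤⇒fits r (suc j) (proj₂ t) = occ

  foldAt-+suc : ∀ {n} (w : Vec Step n) j r → foldAt w (j + suc r) ≡ foldAt w (suc (j + r))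
  foldAt-+suc w j r = cong (foldAt w) (+-suc j r)

  idealAt-downT : ∀ {n} (w : Vec Step n) r j → idealAt w (suc r) (suc j) ≡ true →
                  pathIdeal w (point r (suc j)) ≡ true
  idealAt-downT w r j e = idealAt-intro w r j (InTriangle-downT (idealAt⇒InTriangle w (suc r) (suc j) e))
    (occupied-suc-move⇒occupied (outwardAt w (j + r)) r (foldAt w (j + r))
      (subst (λ a → occupied (suc r) a ≡ true) (trans (foldAt-+suc w j r) (foldAt-suc w (j + r)))
             (idealAt⇒occupied w (suc r) j e)))

  idealAt-downS : ∀ {n} (w : Vec Step n) r j → idealAt w (suc r) (suc j) ≡ true →
                  pathIdeal w (point r (3 + j)) ≡ true
  idealAt-downS w r j e = idealAt-intro w r (2 + j) (InTriangle-downS (idealAt⇒InTriangle w (suc r) (suc j) e))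
    (subst (λ a → occupied r a ≡ true) (sym (foldAt-suc w (suc (j + r))))
      (occupied-suc⇒occupied-move (outwardAt w (suc (j + r))) r (foldAt w (suc (j + r)))
        (subst (λ a → occupied (suc r) a ≡ true) (foldAt-+suc w j r) (idealAt⇒occupied w (suc r) j e))))

  idealAt-⋖ : ∀ {n} (w : Vec Step n) {y} r j → y ⋖ point r j → idealAt w r j ≡ true → pathIdeal w y ≡ true
  idealAt-⋖ w r (suc j) y⋖x e with InTriangle-⋖ {r} {suc j} (idealAt⇒InTriangle w r (suc j) e) y⋖x
  ... | r′ , refl , inj₁ refl = idealAt-downS w r′ j e
  ... | r′ , refl , inj₂ refl = idealAt-downT w r′ j e

  pathIdeal-below : ∀ {n} (w : Vec Step n) {y x} → BelowM k y x → pathIdeal w x ≡ true → pathIdeal w y ≡ true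
  pathIdeal-below w ε                                x∈ = x∈
  pathIdeal-below w {y} (_◅_ {j = z} y⋖z z≼x) x∈ =
    idealAt-⋖ w (z / T) (z % T) (subst (y ⋖_) (point-/% z) (Covers⇒⋖ y⋖z)) (pathIdeal-below w z≼x x∈)

  idealAt-nice : ∀ {n} (w : Vec Step n) r j → idealAt w r j ≡ true → idealAt w r (suc j) ≡ true → ⊥
  idealAt-nice w r (suc j) e₁ e₂ =
    occupied-move-exclusive (outwardAt w (j + r)) r (foldAt w (j + r)) (idealAt⇒occupied w r j e₁)
      (subst (λ a → occupied r a ≡ true) (foldAt-suc w (j + r)) (idealAt⇒occupied w r (suc j) e₂))

  pathIdeal-nice : ∀ {n} (w : Vec Step n) → IsNice (pathIdeal w)
  pathIdeal-nice w y (y∈ , 1+y∈) = idealAt-nice w r j y∈ (begin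
    idealAt w r (suc j)           ≡⟨ sym (pathIdeal-point w r (suc j) 1+j<T) ⟩
    pathIdeal w (point r (suc j)) ≡⟨ cong (pathIdeal w) (+-suc (r * T) j) ⟩
    pathIdeal w (suc (point r j)) ≡⟨ cong (λ v → pathIdeal w (suc v)) (sym (point-/% y)) ⟩
    pathIdeal w (suc y)           ≡⟨ 1+y∈ ⟩
    true                          ∎)
    where
      open ≡-Reasoning
      r j : ℕ
      r = y / T
      j = y % T
      1+j<T : suc j < T
      1+j<T = InTriangle⇒suc<T {r} (idealAt⇒InTriangle w r j y∈)

  pathIdeal-good : ∀ {n} (w : Vec Step n) → IsGoodIdeal k (pathIdeal w)
  pathIdeal-good w =
    ((λ x x∈ → Triangular⇒InM (x / T , x % T , idealAt⇒InTriangle w (x / T) (x % T) x∈ , point-/% x)) ,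
     (λ x y x∈ _ y≼x → pathIdeal-below w y≼x x∈)) ,
    pathIdeal-nice w ,
    λ 1∈ → contradiction (trans (sym 1∈) (trans (pathIdeal-point w 0 1 (s≤s (s≤s z≤n))) (∧-zeroʳ (fits 0 1))))
                         λ ()

-- The path of an ideal

  diagonal⇒suc<T : ∀ {r j i} → j + r ≡ i → i ≤ K → suc j < T
  diagonal⇒suc<T {r} {j} e i≤K = s≤s (s≤s (≤-trans (subst (j ≤_) e (m≤m+n j r)) (≤-trans i≤K (n≤1+n K))))

  module IdealPath (I : Subset) (good : IsGoodIdeal k I) where

    I⊆M : ∀ x → x ∈ I → InM k x
    I⊆M = proj₁ (proj₁ good)

    I-downward : ∀ x y → x ∈ I → InM k y → BelowM k y x → y ∈ I
    I-downward = proj₂ (proj₁ good)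

    I-nice : IsNice I
    I-nice = proj₁ (proj₂ good)

    1∉I : ¬ (1 ∈ I)
    1∉I = proj₂ (proj₂ good)

    cell : ℕ → ℕ → Bool
    cell r j = I (point r (suc j))

    I-point⇒InTriangle : ∀ r j → j < T → I (point r j) ≡ true → InTriangle r j
    I-point⇒InTriangle r j j<T e with InM⇒Triangular (I⊆M _ e)
    ... | r′ , j′ , t , eq with point-injective {r} {r′} j<T (InTriangle⇒<T {r′} t) eq
    ...   | refl , refl = t

    cell⇒InTriangle : ∀ r j → suc j < T → cell r j ≡ true → InTriangle r (suc j)
    cell⇒InTriangle r j = I-point⇒InTriangle r (suc j)

    I-⋖ : ∀ {y x} → Triangular y → y ⋖ x → I x ≡ true → I y ≡ true
    I-⋖ {y} {x} y∈▵ y⋖x x∈ =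
      I-downward x y x∈ y∈M (⋖⇒Covers (proj₁ (I⊆M x x∈)) (proj₁ y∈M) y⋖x ◅ ε)
      where
        y∈M : InM k y
        y∈M = Triangular⇒InM y∈▵

    cell-downT : ∀ r j → suc j < T → cell (suc r) j ≡ true → cell r j ≡ true
    cell-downT r j 1+j<T e =
      I-⋖ (r , suc j , InTriangle-downT (cell⇒InTriangle (suc r) j 1+j<T e) , refl) (inj₂ (point-suc≡+T r (suc j))) e

    cell-downS : ∀ r j → suc j < T → cell (suc r) j ≡ true → cell r (2 + j) ≡ true
    cell-downS r j 1+j<T e =
      I-⋖ (r , 3 + j , InTriangle-downS (cell⇒InTriangle (suc r) j 1+j<T e) , refl) (inj₁ (point-suc≡+S r (suc j))) e

    cell-nice : ∀ r j → cell r j ≡ true → cell r (suc j) ≡ true → ⊥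
    cell-nice r j e₁ e₂ = I-nice (point r (suc j)) (e₁ , subst (λ v → I v ≡ true) (+-suc (r * T) (suc j)) e₂)

    cell-origin : cell 0 0 ≡ false
    cell-origin = ¬-not 1∉I

    -- The step after i moves outward iff the cell in the current row on the
    -- next diagonal belongs to I.
    outwardFor : ℤ → ℕ → Bool
    outwardFor z i = cell (fold z) (suc i ∸ fold z)

    heights : ℕ → ℤ
    heights zero    = + 0
    heights (suc i) = stepHeight (stepFor (outwardFor (heights i) i) (heights i)) +ℤ heights i

    column : ℕ → ℕ
    column i = fold (heights i)

    goesOut : ℕ → Bool
    goesOut i = outwardFor (heights i) i

    steps : ℕ → Step
    steps i = stepFor (goesOut i) (heights i)

    column-suc : ∀ i → column (suc i) ≡ move (goesOut i) (column i)
    column-suc i = fold-stepFor (goesOut i) (heights i)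

    column-≤ : ∀ i → column i ≤ i
    column-≤ zero    = z≤n
    column-≤ (suc i) rewrite column-suc i = ≤-trans (move-≤ (goesOut i) (column i)) (s≤s (column-≤ i))

    Diagonal : ℕ → Set
    Diagonal i = ∀ r j → j + r ≡ i → cell r j ≡ occupied r (column i)

    diagonal-zero : Diagonal 0
    diagonal-zero zero zero _ = cell-origin

    module _ (i : ℕ) (1+i≤K : suc i ≤ K) (diag : Diagonal i) where

      private
        a : ℕ
        a = column i
        b : Bool
        b = goesOut i

      cell-above : ∀ r j → j + r ≡ suc i → a < r → cell r j ≡ false
      cell-above (suc r) j e (s≤s a≤r) = ¬-not λ c →
        <⇒≱ (occupied⇒< r a (trans (sym (diag r j (suc-injective (trans (sym (+-suc j r)) e))))
                                   (cell-downT r j (diagonal⇒suc<T e 1+i≤K) c)))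
            a≤r

      cell-at : ∀ j → j + a ≡ suc i → cell a j ≡ occupied a (move b a)
      cell-at j e = begin
        cell a j             ≡⟨ cong (cell a) (trans (sym (m+n∸n≡m j a)) (cong (_∸ a) e)) ⟩
        cell a (suc i ∸ a)   ≡⟨ sym (occupied-move-self b a) ⟩
        occupied a (move b a) ∎
        where open ≡-Reasoning

      cell-excluded : ∀ r j → j + r ≡ suc i → occupied r a ≡ true → cell r j ≡ false
      cell-excluded r zero    e occ =
        ⊥-elim (<⇒≱ (≤-trans (occupied⇒< r a occ) (column-≤ i)) (subst (i ≤_) (sym e) (n≤1+n i)))
      cell-excluded r (suc j) e occ = ¬-not (cell-nice r j (trans (diag r j (suc-injective e)) occ))

      cell-forced : ∀ r j → j + r ≡ suc i → occupied (suc r) a ≡ true → cell r j ≡ true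
      cell-forced r zero          e occ = ⊥-elim (<⇒≱ (≤-trans (occupied⇒< (suc r) a occ) (column-≤ i))
                                                      (≤-trans (subst (i ≤_) (sym e) (n≤1+n i)) (n≤1+n r)))
      cell-forced r (suc zero)    e occ = ⊥-elim (<⇒≱ (≤-trans (occupied⇒< (suc r) a occ) (column-≤ i))
                                                      (≤-trans (≤-reflexive (sym (suc-injective e))) (n≤1+n r)))
      cell-forced r (suc (suc j)) e occ =
        cell-downS r j (diagonal⇒suc<T e′ (≤-trans (n≤1+n i) 1+i≤K)) (trans (diag (suc r) j e′) occ)
        where
          e′ : j + suc r ≡ i
          e′ = trans (+-suc j r) (suc-injective e)

      cell-below : ∀ r j → j + r ≡ suc i → r < a → cell r j ≡ occupied r (move b a)
      cell-below r j e r<a with occupied r a in occ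
      ... | true  = trans (cell-excluded r j e occ) (sym (¬-not (occupied-move-exclusive b r a occ)))
      ... | false = trans (cell-forced r j e occ′) (sym (occupied-suc⇒occupied-move b r a occ′))
        where
          occ′ : occupied (suc r) a ≡ true
          occ′ = occupied-alternates r a r<a occ

      diagonal-suc : Diagonal (suc i)
      diagonal-suc r j e with <-cmp r a
      ... | tri< r<a _ _ = trans (cell-below r j e r<a) (cong (occupied r) (sym (column-suc i)))
      ... | tri≈ _ refl _ = trans (cell-at j e) (cong (occupied r) (sym (column-suc i)))
      ... | tri> _ _ a<r = trans (cell-above r j e a<r)
                                 (sym (trans (cong (occupied r) (column-suc i))
                                             (≤⇒¬occupied r (move b a) (≤-trans (move-≤ b a) a<r))))

    diagonal : ∀ i → i ≤ K → Diagonal i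
    diagonal zero    _     = diagonal-zero
    diagonal (suc i) 1+i≤K = diagonal-suc i 1+i≤K (diagonal i (≤-trans (n≤1+n i) 1+i≤K))

    -- A nonzero final column would put its top cell outside the triangle.
    column-K≡0 : column K ≡ 0
    column-K≡0 with column K in e
    ... | zero  = refl
    ... | suc m = ⊥-elim (<⇒≱ (begin-strict
          K                       ≡⟨ sym K∸m+m≡K ⟩
          K ∸ m + m               <⟨ s≤s (+-monoʳ-≤ (K ∸ m) (m≤m+n m m)) ⟩
          suc (K ∸ m) + (m + m)   ∎)
          (proj₂ (cell⇒InTriangle m (K ∸ m) (diagonal⇒suc<T K∸m+m≡K ≤-refl) top∈I)))
      where
        open ≤-Reasoning
        K∸m+m≡K : K ∸ m + m ≡ K
        K∸m+m≡K = m∸n+n≡m (≤-trans (n≤1+n m) (subst (_≤ K) e (column-≤ K)))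
        top∈I : cell m (K ∸ m) ≡ true
        top∈I = trans (diagonal K ≤-refl m (K ∸ m) K∸m+m≡K)
                      (trans (cong (occupied m) e) (occupied-move-self true m))

    oddℤ-heights : ∀ i → oddℤ (heights i) ≡ odd i
    oddℤ-heights zero    = refl
    oddℤ-heights (suc i) = trans (oddℤ-step (steps i) (heights i)) (cong not (oddℤ-heights i))

    path : Vec Step K
    path = fromFun K steps

    heightAt-path : ∀ i → i ≤ K → heightAt path i ≡ heights i
    heightAt-path = heightAt-fromFun K steps heights refl (λ _ → refl)

    path-closed : height path ≡ + 0
    path-closed = begin
      height path      ≡⟨ height≡heightAt path ⟩
      heightAt path K  ≡⟨ heightAt-path K ≤-refl ⟩
      heights K        ≡⟨ fold≡0∧even⇒≡0 (heights K) column-K≡0 (trans (oddℤ-heights K) (odd-2* k)) ⟩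
      + 0              ∎
      where open ≡-Reasoning

    idealAt-path : ∀ r j → j < T → idealAt path r j ≡ I (point r j)
    idealAt-path r zero j<T = sym (¬-not λ e → contradiction (proj₁ (I-point⇒InTriangle r 0 j<T e)) λ ())
    idealAt-path r (suc j) j<T with fits r (suc j) in f
    ... | true  = sym (trans (diagonal (j + r) j+r≤K r j refl)
                             (cong (λ z → occupied r (fold z)) (sym (heightAt-path (j + r) j+r≤K))))
      where
        j+r≤K : j + r ≤ K
        j+r≤K = ≤-trans (≤-trans (+-monoʳ-≤ j (m≤m+n r r)) (n≤1+n _)) (fits⇒≤ r (suc j) f)
    ... | false = sym (¬-not λ e →
                    contradiction (trans (sym (≤⇒fits r (suc j) (proj₂ (cell⇒InTriangle r j j<T e)))) f) λ ())

    pathIdeal-path : ∀ x → pathIdeal path x ≡ I x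
    pathIdeal-path x = trans (idealAt-path (x / T) (x % T) (m%n<n x T)) (cong I (sym (point-/% x)))

  path-cong : ∀ {I J} (gI : IsGoodIdeal k I) (gJ : IsGoodIdeal k J) →
              (∀ x → I x ≡ J x) → IdealPath.path I gI ≡ IdealPath.path J gJ
  path-cong {I} {J} gI gJ I≗J = fromFun-cong K λ i → cong₂ stepFor (goesOut-≡ i) (heights-≡ i)
    where
      module PI = IdealPath I gI
      module PJ = IdealPath J gJ
      heights-≡ : ∀ i → PI.heights i ≡ PJ.heights i
      heights-≡ zero    = refl
      heights-≡ (suc i) rewrite heights-≡ i =
        cong (λ b → stepHeight (stepFor b (PJ.heights i)) +ℤ PJ.heights i) (I≗J _)
      goesOut-≡ : ∀ i → PI.goesOut i ≡ PJ.goesOut i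
      goesOut-≡ i rewrite heights-≡ i = I≗J _

-- The two constructions are mutually inverse

  module _ (w : Vec Step K) (closed : height w ≡ + 0) where
    open IdealPath (pathIdeal w) (pathIdeal-good w)

    diagonal-of-fold : ∀ i → (suc i ∸ foldAt w i) + foldAt w i ≡ suc i
    diagonal-of-fold i = m∸n+n≡m (≤-trans (foldAt-≤ w i) (n≤1+n i))

    -- Since w returns to 0, an outward step at i reaches a height at most K − (i + 1),
    -- so the corresponding cell is in the triangle.
    outward⇒fits : ∀ i → suc i ≤ K → outwardAt w i ≡ true →
                   suc (suc i ∸ foldAt w i) + (foldAt w i + foldAt w i) ≤ K
    outward⇒fits i 1+i≤K o≡true = begin
      suc j + (a + a)     ≡⟨ cong suc (sym (+-assoc j a a)) ⟩
      suc (j + a + a)     ≡⟨ cong (λ v → suc (v + a)) (diagonal-of-fold i) ⟩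
      suc (suc i + a)     ≡⟨ cong suc (+-comm (suc i) a) ⟩
      suc a + suc i       ≤⟨ +-monoˡ-≤ (suc i) 1+a≤K∸[1+i] ⟩
      K ∸ suc i + suc i   ≡⟨ m∸n+n≡m 1+i≤K ⟩
      K                   ∎
      where
        open ≤-Reasoning
        a j : ℕ
        a = foldAt w i
        j = suc i ∸ a
        1+a≤K∸[1+i] : suc a ≤ K ∸ suc i
        1+a≤K∸[1+i] = subst (_≤ K ∸ suc i) (trans (foldAt-suc w i) (cong (λ b → move b a) o≡true))
          (foldAt-≤-remaining w (trans (sym (height≡heightAt w)) closed) (K ∸ suc i) (suc i) (m+[n∸m]≡n 1+i≤K))

    goesOut-path : ∀ i → suc i ≤ K → outwardFor (heightAt w i) i ≡ outwardAt w i
    goesOut-path i 1+i≤K = begin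
      cell a j
        ≡⟨ pathIdeal-point w a (suc j) (diagonal⇒suc<T {a} {j} (diagonal-of-fold i) 1+i≤K) ⟩
      fits a (suc j) ∧ occupied a (foldAt w (j + a))
        ≡⟨ cong (λ v → fits a (suc j) ∧ occupied a v) (trans (cong (foldAt w) (diagonal-of-fold i)) (foldAt-suc w i)) ⟩
      fits a (suc j) ∧ occupied a (move o a)
        ≡⟨ cong (fits a (suc j) ∧_) (occupied-move-self o a) ⟩
      fits a (suc j) ∧ o
        ≡⟨ ∧-implied (fits a (suc j)) o (λ o≡true → ≤⇒fits a (suc j) (outward⇒fits i 1+i≤K o≡true)) ⟩
      o
        ∎
      where
        open ≡-Reasoning
        a j : ℕ
        a = foldAt w i
        j = suc i ∸ a
        o : Bool
        o = outwardAt w i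

    step-path : ∀ i → suc i ≤ K → stepFor (outwardFor (heightAt w i) i) (heightAt w i) ≡ stepAt w i
    step-path i 1+i≤K =
      trans (cong (λ b → stepFor b (heightAt w i)) (goesOut-path i 1+i≤K))
            (stepFor-outward (stepAt w i) (heightAt w i))

    heights-path : ∀ i → i ≤ K → heights i ≡ heightAt w i
    heights-path zero    _     = refl
    heights-path (suc i) 1+i≤K rewrite heights-path i (≤-trans (n≤1+n i) 1+i≤K) =
      cong (λ s → stepHeight s +ℤ heightAt w i) (step-path i 1+i≤K)

    path-pathIdeal : path ≡ w
    path-pathIdeal = fromFun-stepAt w steps λ i i<K →
      trans (cong (λ z → stepFor (outwardFor z i) z) (heights-path i (<⇒≤ i<K))) (step-path i i<K)


lemma3 : (k : ℕ) → Bijection (GoodIdeals k) (FD k)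
lemma3 k = record
  { to        = λ (I , good) → path I good , path-closed I good
  ; cong      = λ {(I , gI)} {(J , gJ)} → path-cong k {I} {J} gI gJ
  ; bijective = (λ {x} {y} → injective {x} {y}) , surjective
  }
  where
    open IdealPath k using (path; path-closed; pathIdeal-path)

    injective : ∀ {(I , gI) (J , gJ) : Σ Subset (IsGoodIdeal k)} → path I gI ≡ path J gJ → ∀ x → I x ≡ J x
    injective {I , gI} {J , gJ} e x =
      trans (sym (pathIdeal-path I gI x)) (trans (cong (λ w → pathIdeal k w x) e) (pathIdeal-path J gJ x))

    surjective : ∀ ((w , _) : Σ (Vec Step (2 * k)) (λ w → height w ≡ + 0)) →
                 ∃ λ ((I , _) : Σ Subset (IsGoodIdeal k)) →
                   ∀ {(J , gJ) : Σ Subset (IsGoodIdeal k)} → (∀ x → J x ≡ I x) → path J gJ ≡ w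
    surjective (w , closed) = (pathIdeal k w , pathIdeal-good k w) ,
      λ {(_ , gJ)} J≗I → trans (path-cong k gJ (pathIdeal-good k w) J≗I) (path-pathIdeal k w closed)
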